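{- Let $\Gamma=(Q,S,R)$ be a directed surface chemical reaction network on $\mathbb{Z}^2$. Then there exists a non-deterministic, fully asynchronous two-dimensional cellular automaton $\Gamma'=(Q',\mathcal{N},f)$ with von Neumann neighbourhood (with a suitable initial configuration) which simulates $\Gamma$.
   Context: Directed sCRN on $\mathbb{Z}^2$: finite species set $Q$, initial configuration $S$, reactions unimolecular $A\to B$ or directed bimolecular $(A,B,C,D,d)$, $d\in\{N,E,S,W\}$, which simultaneously turn adjacent cells $A,B$ into $C,D$ when the $B$-cell is the neighbour of the $A$-cell in direction $d$. Reachable set $\mathcal{A}(\Gamma)$ from $S$; terminal set: reachable configurations from which no other configuration is reachable. Cellular automaton on $\mathbb{Z}^2$: finite state set $Q'$, neighbourhood $\mathcal{N}=((0,0),(0,1),(1,0),(0,-1),(-1,0))$, non-deterministic local rule $f$ assigning to each tuple of states of a cell and its N,E,S,W neighbours a set of possible next states. Fully asynchronous dynamics: in one step a single cell is chosen and its state replaced by an element of $f$ of its neighbourhood. Reachable set from the initial configuration; terminal set: reachable configurations that are fixed points of the global update. Simulation of $\mathcal{T}$ by $\mathcal{S}$ under a state representation function $\mathcal{R}:Q_\mathcal{S}\to Q_\mathcal{T}\cup\{\mathrm{UND}\}$ (extended cellwise to $\mathcal{R}^*$, giving UND if any cell maps to UND): (1) $\{\mathcal{R}^*(\alpha'):\alpha'\in\mathcal{A}(\mathcal{S})\}$ equals $\mathcal{A}(\mathcal{T})$ apart from possibly UND, and $\{\mathcal{R}^*(\alpha'):\alpha'\in\mathcal{A}_*(\mathcal{S})\}=\mathcal{A}_*(\mathcal{T})$;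 (2) $\alpha'\to_\mathcal{S}\beta'$ for $\alpha',\beta'\in\mathcal{A}(\mathcal{S})$ implies $\mathcal{R}^*(\alpha')\to_\mathcal{T}\mathcal{R}^*(\beta')$ or one of them is UND; (3) for every $\alpha\in\mathcal{A}(\mathcal{T})$ there is nonempty $\Pi\subseteq\mathcal{A}(\mathcal{S})$ all mapping to $\alpha$ such that for every $\beta\in\mathcal{A}(\mathcal{T})$ with $\alpha\to\beta$: (a) each $\alpha'\in\Pi$ reaches some $\beta'$ with $\mathcal{R}^*(\beta')=\beta$; (b) every $\alpha''\in\mathcal{A}(\mathcal{S})$ with $\mathcal{R}^*(\alpha'')=\alpha$ that reaches some $\beta'$ with $\mathcal{R}^*(\beta')=\beta$ is reachable from some $\alpha'\in\Pi$. "Simulates" means this holds for some $\mathcal{R}$ (which may take the value UND on some states). -}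

module Defs where

open import Data.Integer using (ℤ; +_; -[1+_]; _+_)
open import Data.Nat using (ℕ)
open import Data.Fin using (Fin)
open import Data.Fin.Subset using (Subset) renaming (_∈_ to _∈ˢ_)
open import Data.Product using (Σ; _×_; _,_)
open import Data.List using (List)
open import Data.List.Membership.Propositional using () renaming (_∈_ to _∈ₗ_)
open import Data.Maybe using (Maybe; just)
open import Relation.Binary.PropositionalEquality using (_≡_; _≢_)
open import Relation.Binary.Construct.Closure.ReflexiveTransitive using (Star)

Cell : Set
Cell = ℤ × ℤ

data Dir : Set where
  N E S W : Dir

_⊕_ : Cell → Dir → Cell
(x , y) ⊕ N = x , y + + 1
(x , y) ⊕ E = x + + 1 , y
(x , y) ⊕ S = x , y + -[1+ 0 ]
(x , y) ⊕ W = x + -[1+ 0 ] , y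

Config : Set → Set
Config Q = Cell → Q

-- configurations are compared pointwise (no function extensionality)
_≈_ : {Q : Set} → Config Q → Config Q → Set
α ≈ β = ∀ p → α p ≡ β p

record TS : Set₁ where
  field
    State   : Set
    init    : Config State
    Step    : Config State → Config State → Set
    Final   : Config State → Set

  Reaches : Config State → Config State → Set
  Reaches α β = Σ (Config State) λ γ → Star Step α γ × (γ ≈ β)

  Reachable : Config State → Set
  Reachable α = Reaches init α

  Terminal : Config State → Set
  Terminal α = Reachable α × Final α

data Reaction (k : ℕ) : Set where
  uni : Fin k → Fin k → Reaction k
  bi  : Fin k → Fin k → Fin k → Fin k → Dir → Reaction k

Applies : ∀ {k} → Reaction k → Config (Fin k) → Config (Fin k) → Set
Applies (uni A B) α β =
  Σ Cell λ p → α p ≡ A × β p ≡ B × (∀ q → q ≢ p → β q ≡ α q)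
Applies (bi A B C D d) α β =
  Σ Cell λ p → α p ≡ A × α (p ⊕ d) ≡ B × β p ≡ C × β (p ⊕ d) ≡ D
    × (∀ q → q ≢ p → q ≢ (p ⊕ d) → β q ≡ α q)

record sCRN : Set where
  field
    k         : ℕ
    initial   : Config (Fin k)
    reactions : List (Reaction k)

module _ (Γ : sCRN) where
  open sCRN Γ

  crnStep : Config (Fin k) → Config (Fin k) → Set
  crnStep α β = Σ (Reaction k) λ r → (r ∈ₗ reactions) × Applies r α β

  crnTS-pre : Config (Fin k) → Config (Fin k) → Set
  crnTS-pre α β = Σ (Config (Fin k)) λ γ → Star crnStep α γ × (γ ≈ β)

  sCRN→TS : TS
  sCRN→TS = record
    { State = Fin k
    ; init  = initial
    ; Step  = crnStep
    ; Final = λ α → ∀ β → crnTS-pre α β → β ≈ α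
    }

-- Non-deterministic fully asynchronous CA with von Neumann neighbourhood
-- 𝒩 = ((0,0),(0,1),(1,0),(0,-1),(-1,0)), i.e. (self, N, E, S, W)

record CA : Set where
  field
    m     : ℕ
    f     : Fin m → Fin m → Fin m → Fin m → Fin m → Subset m
    start : Config (Fin m)

module _ (Γ' : CA) where
  open CA Γ'

  local : Config (Fin m) → Cell → Subset m
  local α p = f (α p) (α (p ⊕ N)) (α (p ⊕ E)) (α (p ⊕ S)) (α (p ⊕ W))

  caStep : Config (Fin m) → Config (Fin m) → Set
  caStep α β = Σ Cell λ p → (β p ∈ˢ local α p) × (∀ q → q ≢ p → β q ≡ α q)

  caFixed : Config (Fin m) → Set
  caFixed α = ∀ p s → s ∈ˢ local α p → s ≡ α p

  CA→TS : TS
  CA→TS = record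
    { State = Fin m
    ; init  = start
    ; Step  = caStep
    ; Final = caFixed
    }

-- Simulation of 𝒯 by 𝒮 under R : Q_𝒮 → Q_𝒯 ∪ {UND}  (nothing = UND)

module _ (𝒯 𝒮 : TS) where
  private
    module T = TS 𝒯
    module S = TS 𝒮

  Rep : (S.State → Maybe T.State) → Config S.State → Config T.State → Set
  Rep R α' α = ∀ p → R (α' p) ≡ just (α p)

  record Simulates (R : S.State → Maybe T.State) : Set₁ where
    field
      reach-sound    : ∀ α' α → S.Reachable α' → Rep R α' α → T.Reachable α
      reach-complete : ∀ α → T.Reachable α → Σ _ λ α' → S.Reachable α' × Rep R α' α
      term-sound     : ∀ α' → S.Terminal α' → Σ _ λ α → Rep R α' α × T.Terminal α
      term-complete  : ∀ α → T.Terminal α → Σ _ λ α' → S.Terminal α' × Rep R α' α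
      follow         : ∀ α' β' → S.Reachable α' → S.Reachable β' → S.Reaches α' β' →
                       ∀ α β → Rep R α' α → Rep R β' β → T.Reaches α β
      model          : ∀ α → T.Reachable α →
        Σ (Config S.State → Set) λ Π →
          (Σ _ λ α' → Π α')
          × (∀ α' → Π α' → S.Reachable α' × Rep R α' α)
          × (∀ β → T.Reachable β → T.Reaches α β →
               (∀ α' → Π α' → Σ _ λ β' → S.Reaches α' β' × Rep R β' β)
             × (∀ α'' → S.Reachable α'' → Rep R α'' α →
                  (Σ _ λ β' → S.Reaches α'' β' × Rep R β' β) →
                  Σ _ λ α' → Π α' × S.Reaches α' α''))

{-# OPTIONS --safe #-}
-- Besides one state per species of Γ, the automaton has an initiator and a partner state for each
-- bimolecular reaction (A,B,C,D,d). A cell holding A whose d-neighbour holds B may lock as initiator;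
-- the neighbour may then commit as partner, after which the initiator completes to C and the partner
-- releases to D, while an initiator whose partner never came aborts back to A. Unimolecular reactions
-- are single updates. Reading an initiator as C or A according to whether its partner is in place,
-- and a partner as D, projects every configuration of the automaton onto one of Γ so that each move
-- projects to a reaction of Γ (at commit) or to no change; conversely each reaction of Γ is performed
-- by at most four moves between configurations of plain species, which are the ones R does not send
-- to UND. At a fixed point no initiator survives (it could complete or abort), hence no partner (it
-- could release), and a non-trivial applicable reaction would allow a move, so the terminal
-- configurations correspond too.
module Submission where

open import Defs
open import Data.Bool using (true)
open import Data.Empty using (⊥-elim)
open import Data.Fin as Fin using (Fin)
open import Data.Fin.Properties using (+↔⊎)
open import Data.Fin.Subset using (Subset) renaming (_∈_ to _∈ˢ_)
open import Data.Integer as ℤ using (+_)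
import Data.Integer.Properties as ℤₚ
open import Data.List using (List; []; _∷_; length; lookup)
open import Data.List.Membership.Propositional using (_∈_)
open import Data.List.Membership.Propositional.Properties using (∈-lookup)
open import Data.List.Relation.Unary.Any as Any using (here; there)
open import Data.List.Relation.Unary.Any.Properties using (lookup-index)
open import Data.Maybe using (Maybe; just; nothing)
open import Data.Nat using (ℕ; _+_)
open import Data.Product using (Σ; _×_; _,_; proj₁; proj₂)
open import Data.Product.Properties using (≡-dec)
open import Data.Sum using (_⊎_; inj₁; inj₂; [_,_]′)
open import Data.Sum.Function.Propositional using (_⊎-↔_)
open import Data.Vec using (tabulate)
open import Data.Vec.Properties using (lookup∘tabulate; []=⇒lookup; lookup⇒[]=)
open import Function using (_∘_)
open import Function.Bundles using (Inverse; _↔_; mk↔ₛ′; _⇔_; mk⇔; Equivalence)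
open import Function.Properties.Inverse using (↔-refl; ↔-sym; ↔-trans; ↔⇒↣)
open import Relation.Binary.Definitions using (DecidableEquality)
open import Relation.Binary.PropositionalEquality
open import Relation.Binary.Construct.Closure.ReflexiveTransitive using (Star; ε; _◅_; _◅◅_; gmap)
open import Relation.Nullary using (¬_; Dec; yes; no; does)
open import Relation.Nullary.Decidable using (map′; _×-dec_; _⊎-dec_; ¬?; dec-true; via-injection)

opposite : Dir → Dir
opposite N = S
opposite E = W
opposite S = N
opposite W = E

private
  [i+j]+k≡i : ∀ i {j k} → j ℤ.+ k ≡ + 0 → (i ℤ.+ j) ℤ.+ k ≡ i
  [i+j]+k≡i i {j} {k} j+k≡0 = trans (ℤₚ.+-assoc i j k) (trans (cong (ℤ._+_ i) j+k≡0) (ℤₚ.+-identityʳ i))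

  i+1≢i : ∀ i → i ℤ.+ + 1 ≢ i
  i+1≢i i i+1≡i = ℤₚ.i≢suc[i] (trans (sym i+1≡i) (ℤₚ.+-comm i (+ 1)))

⊕-opposite : ∀ p d → (p ⊕ d) ⊕ opposite d ≡ p
⊕-opposite (x , y) N = cong (x ,_) ([i+j]+k≡i y refl)
⊕-opposite (x , y) E = cong (_, y) ([i+j]+k≡i x refl)
⊕-opposite (x , y) S = cong (x ,_) ([i+j]+k≡i y refl)
⊕-opposite (x , y) W = cong (_, y) ([i+j]+k≡i x refl)

opposite-⊕ : ∀ p d → (p ⊕ opposite d) ⊕ d ≡ p
opposite-⊕ p N = ⊕-opposite p S
opposite-⊕ p E = ⊕-opposite p W
opposite-⊕ p S = ⊕-opposite p N
opposite-⊕ p W = ⊕-opposite p E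

⊕-cancel : ∀ {p q d} → p ⊕ d ≡ q → p ≡ q ⊕ opposite d
⊕-cancel {p} {d = d} p⊕d≡q = trans (sym (⊕-opposite p d)) (cong (_⊕ opposite d) p⊕d≡q)

⊕-≢ : ∀ p d → p ⊕ d ≢ p
⊕-≢ (x , y) N h = i+1≢i y (cong proj₂ h)
⊕-≢ (x , y) E h = i+1≢i x (cong proj₁ h)
⊕-≢ (x , y) S h = i+1≢i y (cong proj₂ (trans (cong (_⊕ N) (sym h)) (⊕-opposite (x , y) S)))
⊕-≢ (x , y) W h = i+1≢i x (cong proj₁ (trans (cong (_⊕ E) (sym h)) (⊕-opposite (x , y) W)))

infix 4 _≟ᶜ_
_≟ᶜ_ : DecidableEquality Cell
_≟ᶜ_ = ≡-dec ℤ._≟_ ℤ._≟_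

around : {X : Set} → Config X → Cell → Dir → X
around δ p d = δ (p ⊕ d)

infixl 25 _[_]≔_
_[_]≔_ : {X : Set} → Config X → Cell → X → Config X
(δ [ p ]≔ s) q with q ≟ᶜ p
... | yes _ = s
... | no _  = δ q

[]≔-updates : ∀ {X} (δ : Config X) p s → (δ [ p ]≔ s) p ≡ s
[]≔-updates δ p s with p ≟ᶜ p
... | yes _   = refl
... | no p≢p  = ⊥-elim (p≢p refl)

[]≔-minimal : ∀ {X} (δ : Config X) p s q → q ≢ p → (δ [ p ]≔ s) q ≡ δ q
[]≔-minimal δ p s q q≢p with q ≟ᶜ p
... | yes q≡p = ⊥-elim (q≢p q≡p)
... | no _    = refl

cell-cases : ∀ {P : Cell → Set} p → P p → (∀ q → q ≢ p → P q) → ∀ q → P q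
cell-cases p at-p off-p q with q ≟ᶜ p
... | yes refl = at-p
... | no q≢p   = off-p q q≢p

AgreeOff : ∀ {X} → Cell → Config X → Config X → Set
AgreeOff p δ δ' = ∀ q → q ≢ p → δ' q ≡ δ q

[]≔-≈ : ∀ {X} {δ δ' : Config X} {p s} → δ' p ≡ s → AgreeOff p δ' δ → δ [ p ]≔ s ≈ δ'
[]≔-≈ {δ = δ} {p = p} δ'p≡s agree = cell-cases p (trans ([]≔-updates δ p _) (sym δ'p≡s)) λ q q≢p →
  trans ([]≔-minimal δ p _ q q≢p) (agree q q≢p)

module ReachesProperties (𝒯 : TS)
                         (step-respˡ : ∀ {α α' β} → α ≈ α' → TS.Step 𝒯 α β → TS.Step 𝒯 α' β) where
  open TS 𝒯

  ≈⇒reaches : ∀ {α β} → α ≈ β → Reaches α β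
  ≈⇒reaches {α} α≈β = α , ε , α≈β

  step⇒reaches : ∀ {α β} → Step α β → Reaches α β
  step⇒reaches {β = β} s = β , s ◅ ε , λ _ → refl

  reaches-respʳ : ∀ {α β β'} → β ≈ β' → Reaches α β → Reaches α β'
  reaches-respʳ β≈β' (γ , ss , γ≈β) = γ , ss , λ p → trans (γ≈β p) (β≈β' p)

  star-respˡ : ∀ {α α' γ} → α ≈ α' → Star Step α γ → Reaches α' γ
  star-respˡ α≈α' ε        = ≈⇒reaches (sym ∘ α≈α')
  star-respˡ α≈α' (s ◅ ss) = _ , step-respˡ α≈α' s ◅ ss , λ _ → refl

  reaches-respˡ : ∀ {α α' β} → α ≈ α' → Reaches α β → Reaches α' β
  reaches-respˡ α≈α' (γ , ss , γ≈β) = reaches-respʳ γ≈β (star-respˡ α≈α' ss)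

  reaches-trans : ∀ {α β γ} → Reaches α β → Reaches β γ → Reaches α γ
  reaches-trans (β' , ss , β'≈β) β→γ with reaches-respˡ (sym ∘ β'≈β) β→γ
  ... | γ' , ts , γ'≈γ = γ' , ss ◅◅ ts , γ'≈γ

  reaches-stable : ∀ {α} → (∀ {α' β} → α' ≈ α → Step α' β → β ≈ α') →
                   ∀ β → Reaches α β → β ≈ α
  reaches-stable {α} stable _ (γ , ss , γ≈β) p = trans (sym (γ≈β p)) (go ss (λ _ → refl) p)
    where
    go : ∀ {α' γ} → Star Step α' γ → α' ≈ α → γ ≈ α
    go ε        α'≈α = α'≈α
    go (s ◅ ss) α'≈α = go ss λ p → trans (stable α'≈α s p) (α'≈α p)

module _ (𝒯 𝒮 : TS) where
  private
    module T = TS 𝒯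
    module S = TS 𝒮

  record Projection (R : S.State → Maybe T.State) : Set where
    field
      T-step-respˡ     : ∀ {α α' β} → α ≈ α' → T.Step α β → T.Step α' β
      S-step-respˡ     : ∀ {α α' β} → α ≈ α' → S.Step α β → S.Step α' β
      embed            : Config T.State → Config S.State
      project          : Config S.State → Config T.State
      embed-cong       : ∀ {α β} → α ≈ β → embed α ≈ embed β
      project-cong     : ∀ {α β} → α ≈ β → project α ≈ project β
      init-embed       : S.init ≈ embed T.init
      embed-represents : ∀ α → Rep 𝒯 𝒮 R (embed α) α
      represents⇒embed : ∀ {α' α} → Rep 𝒯 𝒮 R α' α → α' ≈ embed α
      project-embed    : ∀ α → project (embed α) ≈ α
      project-step     : ∀ {α' β'} → S.Step α' β' → T.Reaches (project α') (project β')
      embed-step       : ∀ {α β} → T.Step α β → S.Reaches (embed α) (embed β)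
      project-final    : ∀ {α'} → S.Final α' → Rep 𝒯 𝒮 R α' (project α') × T.Final (project α')
      embed-final      : ∀ {α} → T.Final α → S.Final (embed α)

  module _ {R : S.State → Maybe T.State} (P : Projection R) where
    open Projection P
    private
      module TR = ReachesProperties 𝒯 T-step-respˡ
      module SR = ReachesProperties 𝒮 S-step-respˡ

    project-reaches : ∀ {α' β'} → S.Reaches α' β' → T.Reaches (project α') (project β')
    project-reaches (γ , ss , γ≈β') = TR.reaches-respʳ (project-cong γ≈β') (go ss)
      where
      go : ∀ {α' γ} → Star S.Step α' γ → T.Reaches (project α') (project γ)
      go ε        = TR.≈⇒reaches λ _ → refl
      go (s ◅ ss) = TR.reaches-trans (project-step s) (go ss)

    embed-reaches : ∀ {α β} → T.Reaches α β → S.Reaches (embed α) (embed β)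
    embed-reaches (γ , ss , γ≈β) = SR.reaches-respʳ (embed-cong γ≈β) (go ss)
      where
      go : ∀ {α γ} → Star T.Step α γ → S.Reaches (embed α) (embed γ)
      go ε        = SR.≈⇒reaches λ _ → refl
      go (s ◅ ss) = SR.reaches-trans (embed-step s) (go ss)

    project-represented : ∀ {α' α} → Rep 𝒯 𝒮 R α' α → project α' ≈ α
    project-represented rep p = trans (project-cong (represents⇒embed rep) p) (project-embed _ p)

    project-reachable : ∀ {α'} → S.Reachable α' → T.Reachable (project α')
    project-reachable r = TR.reaches-respˡ init-projects (project-reaches r)
      where
      init-projects : project S.init ≈ T.init
      init-projects p = trans (project-cong init-embed p) (project-embed T.init p)

    embed-reachable : ∀ {α} → T.Reachable α → S.Reachable (embed α)
    embed-reachable r = SR.reaches-respˡ (sym ∘ init-embed) (embed-reaches r)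

    -- For (3) take Π to be all reachable representatives of α; then (3b) holds with α'' itself.
    projection⇒simulates : Simulates 𝒯 𝒮 R
    projection⇒simulates = record
      { reach-sound    = λ α' α r rep → TR.reaches-respʳ (project-represented rep) (project-reachable r)
      ; reach-complete = λ α r → embed α , embed-reachable r , embed-represents α
      ; term-sound     = λ α' (r , final) →
          project α' , proj₁ (project-final final) , project-reachable r , proj₂ (project-final final)
      ; term-complete  = λ α (r , final) → embed α , (embed-reachable r , embed-final final) , embed-represents α
      ; follow         = λ α' β' _ _ r α β rep-α rep-β →
          TR.reaches-respʳ (project-represented rep-β)
            (TR.reaches-respˡ (project-represented rep-α) (project-reaches r))
      ; model          = λ α r →
          (λ α' → S.Reachable α' × Rep 𝒯 𝒮 R α' α) ,
          (embed α , embed-reachable r , embed-represents α) ,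
          (λ _ in-Π → in-Π) ,
          λ β _ α→β →
            (λ α' (_ , rep) → embed β ,
               SR.reaches-respˡ (sym ∘ represents⇒embed rep) (embed-reaches α→β) ,
               embed-represents β) ,
            (λ α'' r'' rep'' _ → α'' , (r'' , rep'') , SR.≈⇒reaches λ _ → refl)
      }

applies-respˡ : ∀ {k} (r : Reaction k) {α α' β} → α ≈ α' → Applies r α β → Applies r α' β
applies-respˡ (uni a b) α≈α' (p , αp≡a , βp≡b , off) =
  p , trans (sym (α≈α' p)) αp≡a , βp≡b , λ q q≢p → trans (off q q≢p) (α≈α' q)
applies-respˡ (bi a b c e d) α≈α' (p , αp≡a , αq≡b , βp≡c , βq≡e , off) =
  p , trans (sym (α≈α' p)) αp≡a , trans (sym (α≈α' (p ⊕ d))) αq≡b , βp≡c , βq≡e ,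
  λ q q≢p q≢p⊕d → trans (off q q≢p q≢p⊕d) (α≈α' q)

crnStep-respˡ : ∀ Γ {α α' β} → α ≈ α' → crnStep Γ α β → crnStep Γ α' β
crnStep-respˡ Γ α≈α' (r , r∈ , applies) = r , r∈ , applies-respˡ r α≈α' applies

local-cong : ∀ Γ' {α α'} → α ≈ α' → ∀ p → local Γ' α p ≡ local Γ' α' p
local-cong Γ' α≈α' p
  rewrite α≈α' p | α≈α' (p ⊕ N) | α≈α' (p ⊕ E) | α≈α' (p ⊕ S) | α≈α' (p ⊕ W) = refl

caStep-respˡ : ∀ Γ' {α α' β} → α ≈ α' → caStep Γ' α β → caStep Γ' α' β
caStep-respˡ Γ' α≈α' (p , βp∈ , off) =
  p , subst (_ ∈ˢ_) (local-cong Γ' α≈α' p) βp∈ , λ q q≢p → trans (off q q≢p) (α≈α' q)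

module _ {k : ℕ} where
  uni-idle : ∀ {a b} {α β : Config (Fin k)} → b ≡ a → Applies (uni a b) α β → β ≈ α
  uni-idle b≡a (p , αp≡a , βp≡b , off) = cell-cases p (trans βp≡b (trans b≡a (sym αp≡a))) off

  bi-idle : ∀ {a b c e d} {α β : Config (Fin k)} → c ≡ a → e ≡ b →
            Applies (bi a b c e d) α β → β ≈ α
  bi-idle {d = d} c≡a e≡b (p , αp≡a , αq≡b , βp≡c , βq≡e , off) x with x ≟ᶜ p | x ≟ᶜ p ⊕ d
  ... | yes refl | _        = trans βp≡c (trans c≡a (sym αp≡a))
  ... | no _     | yes refl = trans βq≡e (trans e≡b (sym αq≡b))
  ... | no x≢p   | no x≢q   = off x x≢p x≢q

  bi-idle⁻ : ∀ {a b c e d} {α β : Config (Fin k)} → Applies (bi a b c e d) α β → β ≈ α →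
             c ≡ a × e ≡ b
  bi-idle⁻ {d = d} (p , αp≡a , αq≡b , βp≡c , βq≡e , _) β≈α =
    trans (sym βp≡c) (trans (β≈α p) αp≡a) , trans (sym βq≡e) (trans (β≈α (p ⊕ d)) αq≡b)

  uni-applies : ∀ {a b} {α : Config (Fin k)} {p} → α p ≡ a → Applies (uni a b) α (α [ p ]≔ b)
  uni-applies {α = α} {p} αp≡a = p , αp≡a , []≔-updates α p _ , λ q → []≔-minimal α p _ q

  bi-applies : ∀ {a b c e d} {α : Config (Fin k)} {p} → α p ≡ a → α (p ⊕ d) ≡ b →
    Applies (bi a b c e d) α ((α [ p ]≔ c) [ p ⊕ d ]≔ e)
  bi-applies {c = c} {e} {d} {α} {p} αp≡a αq≡b =
    p , αp≡a , αq≡b ,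
    trans ([]≔-minimal _ (p ⊕ d) e p (⊕-≢ p d ∘ sym)) ([]≔-updates α p c) ,
    []≔-updates _ (p ⊕ d) e ,
    λ q q≢p q≢p⊕d → trans ([]≔-minimal _ (p ⊕ d) e q q≢p⊕d) ([]≔-minimal α p c q q≢p)

record Bimolecular (k : ℕ) : Set where
  constructor bimolecular
  field
    A B C D : Fin k
    d       : Dir

module _ {k : ℕ} where
  open Bimolecular

  toReaction : Bimolecular k → Reaction k
  toReaction ρ = bi (A ρ) (B ρ) (C ρ) (D ρ) (d ρ)

  Trivial : Bimolecular k → Set
  Trivial ρ = C ρ ≡ A ρ × D ρ ≡ B ρ

  trivial? : ∀ ρ → Dec (Trivial ρ)
  trivial? ρ = (C ρ Fin.≟ A ρ) ×-dec (D ρ Fin.≟ B ρ)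

  bimoleculars : List (Reaction k) → List (Bimolecular k)
  bimoleculars []                  = []
  bimoleculars (uni _ _ ∷ rs)      = bimoleculars rs
  bimoleculars (bi a b c e x ∷ rs) = bimolecular a b c e x ∷ bimoleculars rs

  ∈-bimoleculars⁺ : ∀ {a b c e x rs} → bi a b c e x ∈ rs → bimolecular a b c e x ∈ bimoleculars rs
  ∈-bimoleculars⁺ (here refl)                          = here refl
  ∈-bimoleculars⁺ {rs = uni _ _ ∷ _}       (there r∈) = ∈-bimoleculars⁺ r∈
  ∈-bimoleculars⁺ {rs = bi _ _ _ _ _ ∷ _}  (there r∈) = there (∈-bimoleculars⁺ r∈)

  ∈-bimoleculars⁻ : ∀ {ρ rs} → ρ ∈ bimoleculars rs → toReaction ρ ∈ rs
  ∈-bimoleculars⁻ {rs = uni _ _ ∷ _}       ρ∈          = there (∈-bimoleculars⁻ ρ∈)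
  ∈-bimoleculars⁻ {rs = bi _ _ _ _ _ ∷ _}  (here refl) = here refl
  ∈-bimoleculars⁻ {rs = bi _ _ _ _ _ ∷ _}  (there ρ∈)  = there (∈-bimoleculars⁻ ρ∈)

  uni≡? : ∀ (a b : Fin k) r → Dec (uni a b ≡ r)
  uni≡? a b (uni a' b')    = map′ (λ (a≡a' , b≡b') → cong₂ uni a≡a' b≡b') (λ { refl → refl , refl })
                               ((a Fin.≟ a') ×-dec (b Fin.≟ b'))
  uni≡? a b (bi _ _ _ _ _) = no λ ()

compass : {X : Set} → X → X → X → X → Dir → X
compass n e s w N = n
compass n e s w E = e
compass n e s w S = s
compass n e s w W = w

∈-tabulate : ∀ {m} {P : Fin m → Set} (P? : ∀ t → Dec (P t)) {t} → t ∈ˢ tabulate (does ∘ P?) ⇔ P t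
∈-tabulate {P = P} P? {t} = mk⇔
  (λ t∈ → does-true (P? t) (trans (sym (lookup∘tabulate (does ∘ P?) t)) ([]=⇒lookup t∈)))
  (λ Pt → lookup⇒[]= t _ (trans (lookup∘tabulate (does ∘ P?) t) (dec-true (P? t) Pt)))
  where
  does-true : ∀ {Q : Set} (Q? : Dec Q) → does Q? ≡ true → Q
  does-true (yes q) _ = q
  does-true (no _)  ()

module LocalRuleCA {St : Set} {m : ℕ} (enumeration : St ↔ Fin m)
                   (Move : (Dir → St) → St → St → Set)
                   (move? : ∀ nb s t → Dec (Move nb s t))
                   (Move-resp : ∀ {nb nb'} → nb ≗ nb' → ∀ {s t} → Move nb s t → Move nb' s t)
                   (start : Cell → St) where
  open Inverse enumeration using (to; from; strictlyInverseˡ; strictlyInverseʳ)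

  encode : (Cell → St) → Config (Fin m)
  encode δ = to ∘ δ

  decode : Config (Fin m) → Cell → St
  decode γ = from ∘ γ

  rule : Fin m → Fin m → Fin m → Fin m → Fin m → Subset m
  rule x n e s w = tabulate λ t → does (move? (compass (from n) (from e) (from s) (from w)) (from x) (from t))

  ca : CA
  ca = record { m = m ; f = rule ; start = encode start }

  Move-subst : ∀ {nb nb' s s' t t'} → nb ≗ nb' → s ≡ s' → t ≡ t' → Move nb s t → Move nb' s' t'
  Move-subst nb≗nb' refl refl = Move-resp nb≗nb'

  ∈-local⇔Move : ∀ γ p t → t ∈ˢ local ca γ p ⇔ Move (around (decode γ) p) (decode γ p) (from t)
  ∈-local⇔Move γ p t = mk⇔
    (Move-resp compass-around ∘ Equivalence.to (∈-tabulate move-here?))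
    (Equivalence.from (∈-tabulate move-here?) ∘ Move-resp (sym ∘ compass-around))
    where
    δ : Cell → St
    δ = decode γ
    nb : Dir → St
    nb = compass (δ (p ⊕ N)) (δ (p ⊕ E)) (δ (p ⊕ S)) (δ (p ⊕ W))
    move-here? : ∀ t → Dec (Move nb (δ p) (from t))
    move-here? t = move? nb (δ p) (from t)
    compass-around : ∀ x → nb x ≡ around δ p x
    compass-around N = refl
    compass-around E = refl
    compass-around S = refl
    compass-around W = refl

  encode-cong : ∀ {δ δ'} → δ ≈ δ' → encode δ ≈ encode δ'
  encode-cong δ≈δ' = cong to ∘ δ≈δ'

  decode-cong : ∀ {γ γ'} → γ ≈ γ' → decode γ ≈ decode γ'
  decode-cong γ≈γ' = cong from ∘ γ≈γ'

  decode-encode : ∀ δ → decode (encode δ) ≈ δ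
  decode-encode δ = strictlyInverseʳ ∘ δ

  encode-decode : ∀ γ → encode (decode γ) ≈ γ
  encode-decode γ = strictlyInverseˡ ∘ γ

  infix 4 _↝_
  _↝_ : (Cell → St) → (Cell → St) → Set
  δ ↝ δ' = Σ Cell λ p → Move (around δ p) (δ p) (δ' p) × AgreeOff p δ δ'

  caStep⇒↝ : ∀ {γ γ'} → caStep ca γ γ' → decode γ ↝ decode γ'
  caStep⇒↝ {γ} {γ'} (p , γ'p∈ , agree) =
    p , Equivalence.to (∈-local⇔Move γ p (γ' p)) γ'p∈ , λ q → cong from ∘ agree q

  ↝⇒caStep : ∀ {δ δ'} → δ ↝ δ' → caStep ca (encode δ) (encode δ')
  ↝⇒caStep {δ} {δ'} (p , move , agree) =
    p ,
    Equivalence.from (∈-local⇔Move (encode δ) p (to (δ' p)))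
      (Move-subst (sym ∘ decode-encode δ ∘ (p ⊕_)) (sym (decode-encode δ p)) (sym (decode-encode δ' p)) move) ,
    λ q → cong to ∘ agree q

  ↝-update : ∀ {δ p s t} → δ p ≡ s → Move (around δ p) s t → δ ↝ δ [ p ]≔ t
  ↝-update {δ} {p} δp≡s move =
    p , Move-subst (λ _ → refl) (sym δp≡s) (sym ([]≔-updates δ p _)) move , []≔-minimal δ p _

  _⇝_ : Config (Fin m) → Config (Fin m) → Set
  _⇝_ = TS.Reaches (CA→TS ca)

  ↝*⇒reaches : ∀ {δ δ' δ''} → Star _↝_ δ δ' → δ' ≈ δ'' → encode δ ⇝ encode δ''
  ↝*⇒reaches moves δ'≈δ'' = _ , gmap encode ↝⇒caStep moves , encode-cong δ'≈δ''

  Stuck : (Cell → St) → Set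
  Stuck δ = ∀ p t → Move (around δ p) (δ p) t → t ≡ δ p

  caFixed⇒Stuck : ∀ {γ} → caFixed ca γ → Stuck (decode γ)
  caFixed⇒Stuck {γ} fixed p t move =
    trans (sym (strictlyInverseʳ t))
      (cong from (fixed p (to t) (Equivalence.from (∈-local⇔Move γ p (to t))
        (Move-subst (λ _ → refl) refl (sym (strictlyInverseʳ t)) move))))

  Stuck⇒caFixed : ∀ {δ} → Stuck δ → caFixed ca (encode δ)
  Stuck⇒caFixed {δ} stuck p x x∈ =
    trans (sym (strictlyInverseˡ x))
      (cong to (stuck p (from x)
        (Move-subst (decode-encode δ ∘ (p ⊕_)) (decode-encode δ p) refl
          (Equivalence.to (∈-local⇔Move (encode δ) p x) x∈))))

module Construction (Γ : sCRN) where
  open sCRN Γ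
  open Bimolecular

  nᵇ : ℕ
  nᵇ = length (bimoleculars reactions)

  ρ : Fin nᵇ → Bimolecular k
  ρ = lookup (bimoleculars reactions)

  data St : Set where
    plain             : Fin k → St
    initiator partner : Fin nᵇ → St

  St↔Fin : St ↔ Fin (k + (nᵇ + nᵇ))
  St↔Fin = ↔-trans St↔⊎ (↔-trans (↔-refl ⊎-↔ ↔-sym +↔⊎) (↔-sym +↔⊎))
    where
    St↔⊎ : St ↔ (Fin k ⊎ (Fin nᵇ ⊎ Fin nᵇ))
    St↔⊎ = mk↔ₛ′
      (λ { (plain a) → inj₁ a ; (initiator i) → inj₂ (inj₁ i) ; (partner i) → inj₂ (inj₂ i) })
      (λ { (inj₁ a) → plain a ; (inj₂ (inj₁ i)) → initiator i ; (inj₂ (inj₂ i)) → partner i })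
      (λ { (inj₁ _) → refl ; (inj₂ (inj₁ _)) → refl ; (inj₂ (inj₂ _)) → refl })
      (λ { (plain _) → refl ; (initiator _) → refl ; (partner _) → refl })

  infix 4 _≟ˢ_
  _≟ˢ_ : DecidableEquality St
  _≟ˢ_ = via-injection (↔⇒↣ St↔Fin) Fin._≟_

  plain-injective : ∀ {a b} → plain a ≡ plain b → a ≡ b
  plain-injective refl = refl

  partner-injective : ∀ {i j} → partner i ≡ partner j → i ≡ j
  partner-injective refl = refl

  plain≢initiator : ∀ {a i} → plain a ≢ initiator i
  plain≢initiator ()

  Unpartnered : St → Set
  Unpartnered s = ∀ {i} → s ≢ partner i

  plain-unpartnered : ∀ {a} → Unpartnered (plain a)
  plain-unpartnered ()

  initiator-unpartnered : ∀ {j} → Unpartnered (initiator j)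
  initiator-unpartnered ()

  -- Trivial reactions must not lock, or a terminal configuration of Γ would not be a fixed point.
  data Move (nb : Dir → St) : St → St → Set where
    react    : ∀ {a b} → uni a b ∈ reactions → Move nb (plain a) (plain b)
    lock     : ∀ {a i} → a ≡ A (ρ i) → nb (d (ρ i)) ≡ plain (B (ρ i)) → ¬ Trivial (ρ i) →
               Move nb (plain a) (initiator i)
    commit   : ∀ {b i} → b ≡ B (ρ i) → nb (opposite (d (ρ i))) ≡ initiator i → Move nb (plain b) (partner i)
    complete : ∀ {i c} → nb (d (ρ i)) ≡ partner i → c ≡ C (ρ i) → Move nb (initiator i) (plain c)
    abort    : ∀ {i c} → nb (d (ρ i)) ≢ partner i → c ≡ A (ρ i) → Move nb (initiator i) (plain c)
    release  : ∀ {i c} → nb (opposite (d (ρ i))) ≢ initiator i → c ≡ D (ρ i) → Move nb (partner i) (plain c)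

  move? : ∀ nb s t → Dec (Move nb s t)
  move? nb (plain a) (plain b) =
    map′ react (λ { (react r∈) → r∈ }) (Any.any? (uni≡? a b) reactions)
  move? nb (plain a) (initiator i) =
    map′ (λ (a≡ , nb≡ , nontrivial) → lock a≡ nb≡ nontrivial)
      (λ { (lock a≡ nb≡ nontrivial) → a≡ , nb≡ , nontrivial })
      ((a Fin.≟ A (ρ i)) ×-dec (nb (d (ρ i)) ≟ˢ plain (B (ρ i))) ×-dec ¬? (trivial? (ρ i)))
  move? nb (plain b) (partner i) =
    map′ (λ (b≡ , nb≡) → commit b≡ nb≡) (λ { (commit b≡ nb≡) → b≡ , nb≡ })
      ((b Fin.≟ B (ρ i)) ×-dec (nb (opposite (d (ρ i))) ≟ˢ initiator i))
  move? nb (initiator i) (plain c) =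
    map′ [ (λ (nb≡ , c≡) → complete nb≡ c≡) , (λ (nb≢ , c≡) → abort nb≢ c≡) ]′
      (λ { (complete nb≡ c≡) → inj₁ (nb≡ , c≡) ; (abort nb≢ c≡) → inj₂ (nb≢ , c≡) })
      (((nb (d (ρ i)) ≟ˢ partner i) ×-dec (c Fin.≟ C (ρ i)))
        ⊎-dec (¬? (nb (d (ρ i)) ≟ˢ partner i) ×-dec (c Fin.≟ A (ρ i))))
  move? nb (partner i) (plain c) =
    map′ (λ (nb≢ , c≡) → release nb≢ c≡) (λ { (release nb≢ c≡) → nb≢ , c≡ })
      (¬? (nb (opposite (d (ρ i))) ≟ˢ initiator i) ×-dec (c Fin.≟ D (ρ i)))
  move? nb (initiator _) (initiator _) = no λ ()
  move? nb (initiator _) (partner _)   = no λ ()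
  move? nb (partner _)   (initiator _) = no λ ()
  move? nb (partner _)   (partner _)   = no λ ()

  Move-resp : ∀ {nb nb'} → nb ≗ nb' → ∀ {s t} → Move nb s t → Move nb' s t
  Move-resp nb≗nb' (react r∈)               = react r∈
  Move-resp nb≗nb' (lock a≡ nb≡ nontrivial) = lock a≡ (trans (sym (nb≗nb' _)) nb≡) nontrivial
  Move-resp nb≗nb' (commit b≡ nb≡)          = commit b≡ (trans (sym (nb≗nb' _)) nb≡)
  Move-resp nb≗nb' (complete nb≡ c≡)        = complete (trans (sym (nb≗nb' _)) nb≡) c≡
  Move-resp nb≗nb' (abort nb≢ c≡)           = abort (nb≢ ∘ trans (nb≗nb' _)) c≡
  Move-resp nb≗nb' (release nb≢ c≡)         = release (nb≢ ∘ trans (nb≗nb' _)) c≡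

  open LocalRuleCA St↔Fin Move move? Move-resp (plain ∘ initial) public

  data ReactionStep (α β : Config (Fin k)) : Set where
    uni-step : ∀ {a b} → uni a b ∈ reactions → Applies (uni a b) α β → ReactionStep α β
    bi-step  : ∀ i → Applies (toReaction (ρ i)) α β → ReactionStep α β

  ReactionStep⇒crnStep : ∀ {α β} → ReactionStep α β → crnStep Γ α β
  ReactionStep⇒crnStep (uni-step r∈ applies) = _ , r∈ , applies
  ReactionStep⇒crnStep (bi-step i applies)   = _ , ∈-bimoleculars⁻ {ρ = ρ i} (∈-lookup i) , applies

  crnStep⇒ReactionStep : ∀ {α β} → crnStep Γ α β → ReactionStep α β
  crnStep⇒ReactionStep (uni _ _ , r∈ , applies) = uni-step r∈ applies
  crnStep⇒ReactionStep {α} {β} (bi a b c e x , r∈ , applies) =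
    bi-step (Any.index ρ∈) (subst (λ ρ → Applies (toReaction ρ) α β) (lookup-index ρ∈) applies)
    where
    ρ∈ : bimolecular a b c e x ∈ bimoleculars reactions
    ρ∈ = ∈-bimoleculars⁺ r∈

  read : St → (Dir → St) → Fin k
  read (plain a)     nb = a
  read (initiator i) nb with nb (d (ρ i)) ≟ˢ partner i
  ... | yes _ = C (ρ i)
  ... | no _  = A (ρ i)
  read (partner i)   nb = D (ρ i)

  read-paired : ∀ nb {i} → nb (d (ρ i)) ≡ partner i → read (initiator i) nb ≡ C (ρ i)
  read-paired nb {i} paired with nb (d (ρ i)) ≟ˢ partner i
  ... | yes _       = refl
  ... | no unpaired = ⊥-elim (unpaired paired)

  read-unpaired : ∀ nb {i} → nb (d (ρ i)) ≢ partner i → read (initiator i) nb ≡ A (ρ i)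
  read-unpaired nb {i} unpaired with nb (d (ρ i)) ≟ˢ partner i
  ... | yes paired = ⊥-elim (unpaired paired)
  ... | no _       = refl

  read-initiator-cong : ∀ i nb nb' → nb (d (ρ i)) ≡ nb' (d (ρ i)) →
                        read (initiator i) nb ≡ read (initiator i) nb'
  read-initiator-cong i nb nb' nb≡nb' = by-cases (nb (d (ρ i)) ≟ˢ partner i)
    where
    by-cases : Dec (nb (d (ρ i)) ≡ partner i) → read (initiator i) nb ≡ read (initiator i) nb'
    by-cases (yes paired)  = trans (read-paired nb paired) (sym (read-paired nb' (trans (sym nb≡nb') paired)))
    by-cases (no unpaired) = trans (read-unpaired nb unpaired) (sym (read-unpaired nb' (unpaired ∘ trans nb≡nb')))

  read-cong : ∀ s {nb nb'} → nb ≗ nb' → read s nb ≡ read s nb'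
  read-cong (plain _)     _                = refl
  read-cong (initiator i) {nb} {nb'} nb≗nb' = read-initiator-cong i nb nb' (nb≗nb' _)
  read-cong (partner _)   _                = refl

  value : (Cell → St) → Config (Fin k)
  value δ p = read (δ p) (around δ p)

  value-≡ : ∀ δ {p s} → δ p ≡ s → value δ p ≡ read s (around δ p)
  value-≡ δ {p} = cong (λ s → read s (around δ p))

  value-paired : ∀ δ {p i} → δ p ≡ initiator i → δ (p ⊕ d (ρ i)) ≡ partner i → value δ p ≡ C (ρ i)
  value-paired δ {p} δp≡ paired = trans (value-≡ δ δp≡) (read-paired (around δ p) paired)

  value-unpaired : ∀ δ {p i} → δ p ≡ initiator i → δ (p ⊕ d (ρ i)) ≢ partner i → value δ p ≡ A (ρ i)
  value-unpaired δ {p} δp≡ unpaired = trans (value-≡ δ δp≡) (read-unpaired (around δ p) unpaired)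

  value-cong : ∀ {δ δ'} → δ ≈ δ' → value δ ≈ value δ'
  value-cong {δ} {δ'} δ≈δ' p = trans (value-≡ δ (δ≈δ' p)) (read-cong (δ' p) (δ≈δ' ∘ (p ⊕_)))

  value-off : ∀ {δ δ' q} → AgreeOff q δ δ' → ∀ {x} → x ≢ q →
    (∀ i → δ x ≡ initiator i → x ⊕ d (ρ i) ≡ q → δ q ≢ partner i × δ' q ≢ partner i) →
    value δ' x ≡ value δ x
  value-off {δ} {δ'} {q} agree {x} x≢q unpaired = trans (value-≡ δ' (agree x x≢q)) (same (δ x) refl)
    where
    same : ∀ s → δ x ≡ s → read s (around δ' x) ≡ read s (around δ x)
    same (plain _)     _ = refl
    same (partner _)   _ = refl
    same (initiator i) δx≡ with x ⊕ d (ρ i) ≟ᶜ q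
    ... | no x⊕d≢q  = read-initiator-cong i (around δ' x) (around δ x) (agree _ x⊕d≢q)
    ... | yes x⊕d≡q =
      let (δq≢ , δ'q≢) = unpaired i δx≡ x⊕d≡q
      in trans (read-unpaired (around δ' x) (δ'q≢ ∘ trans (cong δ' (sym x⊕d≡q))))
               (sym (read-unpaired (around δ x) (δq≢ ∘ trans (cong δ (sym x⊕d≡q)))))

  value-off-unpartnered : ∀ {δ δ' q s t} → δ q ≡ s → δ' q ≡ t → Unpartnered s → Unpartnered t →
    AgreeOff q δ δ' → AgreeOff q (value δ) (value δ')
  value-off-unpartnered δq≡s δ'q≡t s-unpartnered t-unpartnered agree x x≢q =
    value-off agree x≢q λ _ _ _ → s-unpartnered ∘ trans (sym δq≡s) , t-unpartnered ∘ trans (sym δ'q≡t)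

  value-commit : ∀ {δ δ' q b i} → δ q ≡ plain b → δ' q ≡ partner i → AgreeOff q δ δ' →
    b ≡ B (ρ i) → δ (q ⊕ opposite (d (ρ i))) ≡ initiator i →
    Applies (toReaction (ρ i)) (value δ) (value δ')
  value-commit {δ} {δ'} {q} {b} {i} δq≡ δ'q≡ agree b≡B locked =
    p , initiator-before , partner-before , initiator-after , partner-after , elsewhere
    where
    p : Cell
    p = q ⊕ opposite (d (ρ i))
    p⊕d≡q : p ⊕ d (ρ i) ≡ q
    p⊕d≡q = opposite-⊕ q (d (ρ i))
    p≢q : p ≢ q
    p≢q = ⊕-≢ q (opposite (d (ρ i)))
    initiator-before : value δ p ≡ A (ρ i)
    initiator-before =
      value-unpaired δ locked (plain-unpartnered ∘ trans (sym δq≡) ∘ trans (cong δ (sym p⊕d≡q)))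
    partner-before : value δ (p ⊕ d (ρ i)) ≡ B (ρ i)
    partner-before = trans (cong (value δ) p⊕d≡q) (trans (value-≡ δ δq≡) b≡B)
    initiator-after : value δ' p ≡ C (ρ i)
    initiator-after = value-paired δ' (trans (agree p p≢q) locked) (trans (cong δ' p⊕d≡q) δ'q≡)
    partner-after : value δ' (p ⊕ d (ρ i)) ≡ D (ρ i)
    partner-after = trans (cong (value δ') p⊕d≡q) (value-≡ δ' δ'q≡)
    paired-only-at-p : ∀ {x} j → x ⊕ d (ρ j) ≡ q → δ' q ≡ partner j → x ≡ p
    paired-only-at-p j x⊕d≡q δ'q≡j with partner-injective (trans (sym δ'q≡) δ'q≡j)
    ... | refl = ⊕-cancel x⊕d≡q
    elsewhere : ∀ x → x ≢ p → x ≢ p ⊕ d (ρ i) → value δ' x ≡ value δ x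
    elsewhere x x≢p x≢p⊕d =
      value-off agree (λ x≡q → x≢p⊕d (trans x≡q (sym p⊕d≡q))) λ j _ x⊕d≡q →
        plain-unpartnered ∘ trans (sym δq≡) , x≢p ∘ paired-only-at-p j x⊕d≡q

  value-release : ∀ {δ δ' q i c} → δ q ≡ partner i → δ' q ≡ plain c → AgreeOff q δ δ' →
    δ (q ⊕ opposite (d (ρ i))) ≢ initiator i → AgreeOff q (value δ) (value δ')
  value-release {δ} {δ'} {q} {i} δq≡ δ'q≡ agree unlocked x x≢q =
    value-off agree x≢q λ j δx≡ x⊕d≡q →
      not-paired j δx≡ x⊕d≡q , plain-unpartnered ∘ trans (sym δ'q≡)
    where
    not-paired : ∀ j → δ x ≡ initiator j → x ⊕ d (ρ j) ≡ q → δ q ≢ partner j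
    not-paired j δx≡ x⊕d≡q δq≡j with partner-injective (trans (sym δq≡) δq≡j)
    ... | refl = unlocked (trans (cong δ (sym (⊕-cancel x⊕d≡q))) δx≡)

  value-step : ∀ {δ δ'} → δ ↝ δ' → ReactionStep (value δ) (value δ') ⊎ value δ' ≈ value δ
  value-step {δ} {δ'} (q , move , agree) = go refl refl move
    where
    go : ∀ {s t} → δ q ≡ s → δ' q ≡ t → Move (around δ q) s t →
         ReactionStep (value δ) (value δ') ⊎ value δ' ≈ value δ
    go δq≡ δ'q≡ (react r∈) =
      inj₁ (uni-step r∈ (q , value-≡ δ δq≡ , value-≡ δ' δ'q≡ ,
        value-off-unpartnered δq≡ δ'q≡ plain-unpartnered plain-unpartnered agree))
    go δq≡ δ'q≡ (lock {i = i} a≡A nb≡B _) =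
      inj₂ (cell-cases q
        (trans (value-unpaired δ' δ'q≡ target-unpartnered) (sym (trans (value-≡ δ δq≡) a≡A)))
        (value-off-unpartnered δq≡ δ'q≡ plain-unpartnered initiator-unpartnered agree))
      where
      target-unpartnered : δ' (q ⊕ d (ρ i)) ≢ partner i
      target-unpartnered = plain-unpartnered ∘ trans (sym nb≡B) ∘ trans (sym (agree _ (⊕-≢ q _)))
    go δq≡ δ'q≡ (commit b≡B locked) = inj₁ (bi-step _ (value-commit δq≡ δ'q≡ agree b≡B locked))
    go δq≡ δ'q≡ (complete paired c≡C) =
      inj₂ (cell-cases q (trans (value-≡ δ' δ'q≡) (trans c≡C (sym (value-paired δ δq≡ paired))))
        (value-off-unpartnered δq≡ δ'q≡ initiator-unpartnered plain-unpartnered agree))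
    go δq≡ δ'q≡ (abort unpaired c≡A) =
      inj₂ (cell-cases q (trans (value-≡ δ' δ'q≡) (trans c≡A (sym (value-unpaired δ δq≡ unpaired))))
        (value-off-unpartnered δq≡ δ'q≡ initiator-unpartnered plain-unpartnered agree))
    go δq≡ δ'q≡ (release unlocked c≡D) =
      inj₂ (cell-cases q (trans (value-≡ δ' δ'q≡) (trans c≡D (sym (value-≡ δ δq≡))))
        (value-release δq≡ δ'q≡ agree unlocked))

  embed : Config (Fin k) → Config (Fin (k + (nᵇ + nᵇ)))
  embed α = encode (plain ∘ α)

  lift-uni : ∀ {α β a b} → uni a b ∈ reactions → Applies (uni a b) α β → embed α ⇝ embed β
  lift-uni r∈ (p , αp≡a , βp≡b , off) =
    ↝*⇒reaches (↝-update (cong plain αp≡a) (react r∈) ◅ ε)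
      ([]≔-≈ (cong plain βp≡b) λ q q≢p → cong plain (sym (off q q≢p)))

  lift-bi : ∀ {α β} i → ¬ Trivial (ρ i) → Applies (toReaction (ρ i)) α β → embed α ⇝ embed β
  lift-bi {α} {β} i nontrivial (p , αp≡A , αq≡B , βp≡C , βq≡D , off) =
    ↝*⇒reaches (locking ◅ committing ◅ completing ◅ releasing ◅ ε) final
    where
    q : Cell
    q = p ⊕ d (ρ i)
    q≢p : q ≢ p
    q≢p = ⊕-≢ p (d (ρ i))
    δ₀ δ₁ δ₂ δ₃ δ₄ : Cell → St
    δ₀ = plain ∘ α
    δ₁ = δ₀ [ p ]≔ initiator i
    δ₂ = δ₁ [ q ]≔ partner i
    δ₃ = δ₂ [ p ]≔ plain (C (ρ i))
    δ₄ = δ₃ [ q ]≔ plain (D (ρ i))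
    locking : δ₀ ↝ δ₁
    locking = ↝-update refl (lock αp≡A (cong plain αq≡B) nontrivial)
    committing : δ₁ ↝ δ₂
    committing = ↝-update ([]≔-minimal δ₀ p _ q q≢p)
      (commit αq≡B (trans (cong δ₁ (⊕-opposite p (d (ρ i)))) ([]≔-updates δ₀ p _)))
    completing : δ₂ ↝ δ₃
    completing = ↝-update (trans ([]≔-minimal δ₁ q _ p (q≢p ∘ sym)) ([]≔-updates δ₀ p _))
      (complete ([]≔-updates δ₁ q _) refl)
    released : δ₃ (q ⊕ opposite (d (ρ i))) ≡ plain (C (ρ i))
    released = trans (cong δ₃ (⊕-opposite p (d (ρ i)))) ([]≔-updates δ₂ p _)
    releasing : δ₃ ↝ δ₄
    releasing = ↝-update (trans ([]≔-minimal δ₂ p _ q q≢p) ([]≔-updates δ₁ q _))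
      (release (plain≢initiator ∘ trans (sym released)) refl)
    final : δ₄ ≈ (plain ∘ β)
    final = cell-cases q (trans ([]≔-updates δ₃ q _) (cong plain (sym βq≡D))) λ x x≢q →
      cell-cases {P = λ x → x ≢ q → δ₄ x ≡ plain (β x)} p
        (λ p≢q → trans ([]≔-minimal δ₃ q _ p p≢q)
                   (trans ([]≔-updates δ₂ p _) (cong plain (sym βp≡C))))
        (λ x x≢p x≢q → begin
          δ₄ x         ≡⟨ []≔-minimal δ₃ q _ x x≢q ⟩
          δ₃ x         ≡⟨ []≔-minimal δ₂ p _ x x≢p ⟩
          δ₂ x         ≡⟨ []≔-minimal δ₁ q _ x x≢q ⟩
          δ₁ x         ≡⟨ []≔-minimal δ₀ p _ x x≢p ⟩
          plain (α x)  ≡⟨ cong plain (sym (off x x≢p x≢q)) ⟩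
          plain (β x)  ∎)
        x x≢q
      where open ≡-Reasoning

  lift : ∀ {α β} → ReactionStep α β → embed α ⇝ embed β
  lift (uni-step r∈ applies) = lift-uni r∈ applies
  lift (bi-step i applies) with trivial? (ρ i)
  ... | yes (C≡A , D≡B) = ↝*⇒reaches ε (cong plain ∘ sym ∘ bi-idle C≡A D≡B applies)
  ... | no nontrivial   = lift-bi i nontrivial applies

  module _ {δ} (stuck : Stuck δ) where
    stuck-at : ∀ {p s t} → δ p ≡ s → Move (around δ p) s t → t ≡ s
    stuck-at {p} δp≡s move = trans (stuck p _ (Move-subst (λ _ → refl) (sym δp≡s) refl move)) δp≡s

    stuck-no-initiator : ∀ {p i} → δ p ≢ initiator i
    stuck-no-initiator {p} {i} δp≡ with δ (p ⊕ d (ρ i)) ≟ˢ partner i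
    ... | yes paired  = plain≢initiator (stuck-at δp≡ (complete paired refl))
    ... | no unpaired = plain≢initiator (stuck-at δp≡ (abort unpaired refl))

    stuck-no-partner : ∀ {p i} → δ p ≢ partner i
    stuck-no-partner {p} {i} δp≡ with δ (p ⊕ opposite (d (ρ i))) ≟ˢ initiator i
    ... | yes locked  = stuck-no-initiator locked
    ... | no unlocked = plain-unpartnered (stuck-at δp≡ (release unlocked refl))

    stuck-plain : ∀ p → δ p ≡ plain (value δ p)
    stuck-plain p = by-cases (δ p) refl
      where
      by-cases : ∀ s → δ p ≡ s → δ p ≡ plain (value δ p)
      by-cases (plain _)     δp≡ = trans δp≡ (cong plain (sym (value-≡ δ δp≡)))
      by-cases (initiator _) δp≡ = ⊥-elim (stuck-no-initiator δp≡)
      by-cases (partner _)   δp≡ = ⊥-elim (stuck-no-partner δp≡)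

    stuck-plain-at : ∀ {α} → α ≈ value δ → ∀ x {a} → α x ≡ a → δ x ≡ plain a
    stuck-plain-at α≈ x αx≡a = trans (stuck-plain x) (cong plain (trans (sym (α≈ x)) αx≡a))

    stuck-idle : ∀ {α β} → α ≈ value δ → ReactionStep α β → β ≈ α
    stuck-idle α≈ (uni-step r∈ applies@(p , αp≡a , _)) =
      uni-idle (plain-injective (stuck-at (stuck-plain-at α≈ p αp≡a) (react r∈))) applies
    stuck-idle α≈ (bi-step i applies@(p , αp≡A , αq≡B , _)) with trivial? (ρ i)
    ... | yes (C≡A , D≡B) = bi-idle C≡A D≡B applies
    ... | no nontrivial   = ⊥-elim (plain≢initiator (sym
            (stuck-at (stuck-plain-at α≈ p αp≡A) (lock refl (stuck-plain-at α≈ _ αq≡B) nontrivial))))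

  final-stuck : ∀ {α} → TS.Final (sCRN→TS Γ) α → Stuck (plain ∘ α)
  final-stuck {α} final p _ = no-move
    where
    idle : ∀ {β} → crnStep Γ α β → β ≈ α
    idle step = final _ (_ , step ◅ ε , λ _ → refl)
    no-move : ∀ {t} → Move (around (plain ∘ α) p) (plain (α p)) t → t ≡ plain (α p)
    no-move (react r∈) = cong plain (trans (sym ([]≔-updates α p _)) (idle (_ , r∈ , uni-applies refl) p))
    no-move (lock {i = i} αp≡A nb≡B nontrivial) =
      ⊥-elim (nontrivial (bi-idle⁻ applies (idle (ReactionStep⇒crnStep (bi-step i applies)))))
      where
      applies : Applies (toReaction (ρ i)) α ((α [ p ]≔ C (ρ i)) [ p ⊕ d (ρ i) ]≔ D (ρ i))
      applies = bi-applies αp≡A (plain-injective nb≡B)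
    no-move (commit _ ())

  represent : St → Maybe (Fin k)
  represent (plain a) = just a
  represent _         = nothing

  represent-just : ∀ {s a} → represent s ≡ just a → s ≡ plain a
  represent-just {plain _}     refl = refl
  represent-just {initiator _} ()
  represent-just {partner _}   ()

  R : Fin (k + (nᵇ + nᵇ)) → Maybe (Fin k)
  R = represent ∘ Inverse.from St↔Fin

  projection : Projection (sCRN→TS Γ) (CA→TS ca) R
  projection = record
    { T-step-respˡ     = crnStep-respˡ Γ
    ; S-step-respˡ     = caStep-respˡ ca
    ; embed            = embed
    ; project          = value ∘ decode
    ; embed-cong       = λ α≈β → encode-cong (cong plain ∘ α≈β)
    ; project-cong     = value-cong ∘ decode-cong
    ; init-embed       = λ _ → refl
    ; embed-represents = λ α → cong represent ∘ decode-encode (plain ∘ α)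
    ; represents⇒embed = λ {γ} rep p → trans (sym (encode-decode γ p)) (encode-cong (represent-just ∘ rep) p)
    ; project-embed    = λ α → value-≡ (decode (embed α)) ∘ decode-encode (plain ∘ α)
    ; project-step     = λ step →
        [ CR.step⇒reaches ∘ ReactionStep⇒crnStep , (λ e → CR.≈⇒reaches (sym ∘ e)) ]′ (value-step (caStep⇒↝ step))
    ; embed-step       = lift ∘ crnStep⇒ReactionStep
    ; project-final    = λ fixed → let stuck = caFixed⇒Stuck fixed in
        cong represent ∘ stuck-plain stuck ,
        CR.reaches-stable (λ α≈ → stuck-idle stuck α≈ ∘ crnStep⇒ReactionStep)
    ; embed-final      = Stuck⇒caFixed ∘ final-stuck
    }
    where
    module CR = ReachesProperties (sCRN→TS Γ) (crnStep-respˡ Γ)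

theorem5 : (Γ : sCRN) →
    Σ CA λ Γ' →
    Σ (Fin (CA.m Γ') → Maybe (Fin (sCRN.k Γ))) λ R →
    Simulates (sCRN→TS Γ) (CA→TS Γ') R
theorem5 Γ = ca , R , projection⇒simulates _ _ projection
  where open Construction Γ
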